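{- For every integer $d \geq 1$, the Ehrhart polynomial $E_{\mathrm{St}_d^\ast}(n)$ of the $d$-dimensional Stasheff polytope $$\mathrm{St}_d^\ast = \{(x_1,\ldots,x_d)\in\mathbb{R}^d \mid -1\le x_i\le 1 \ (1\le i\le d),\ x_j+\cdots+x_k\le 1\ (1\le j<k\le d)\}$$ is magic positive.
   Context: For a lattice polytope $P\subset\mathbb{R}^d$, its Ehrhart polynomial $E_P(n)$ is the polynomial with $E_P(n)=|nP\cap\mathbb{Z}^d|$ for all integers $n>0$. The polytope $\mathrm{St}_d^\ast$ is the polar dual $\{y\in\mathbb{R}^d\mid \langle x,y\rangle\le 1 \ \forall x\in \mathrm{St}_d\}$ of $\mathrm{St}_d=\mathrm{conv}(\{\pm\mathbf{e}_i: 1\le i\le d\}\cup\{\mathbf{e}_i+\cdots+\mathbf{e}_j : 1\le i<j\le d\})$ (the Stasheff polytope/associahedron); it is a reflexive lattice polytope. A polynomial $f(n)$ of degree at most $d$ is called magic positive (with respect to $d$) if, writing $f(n)=\sum_{i=0}^d a_i n^i(1+n)^{d-i}$ with real $a_i$, one has $a_0,\ldots,a_d\ge 0$. -}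

module Defs where

open import Data.Nat as ℕ using (ℕ; zero; suc)
open import Data.Integer as ℤ using (ℤ; +_; -_)
import Data.Integer.Properties as ℤP
open import Data.Rational as ℚ using (ℚ; 0ℚ; 1ℚ)
open import Data.Fin as Fin using (Fin; toℕ)
import Data.Fin.Properties as FinP
open import Data.Vec as Vec using (Vec; []; _∷_; lookup)
open import Data.List as List using (List; []; _∷_; upTo; allFin; map; concatMap; filter; length)
open import Data.Product using (_×_; Σ; ∃; _,_)
open import Relation.Binary.PropositionalEquality using (_≡_)
open import Relation.Nullary using (Dec; yes; no)
open import Relation.Nullary.Decidable using (_×-dec_; _→-dec_)
open import Relation.Unary using (Decidable)

range : ℕ → List ℤ
range n = map (λ i → (+ i) ℤ.- (+ n)) (upTo (suc (2 ℕ.* n)))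

cube : ℕ → (d : ℕ) → List (Vec ℤ d)
cube n zero    = [] ∷ []
cube n (suc d) = concatMap (λ v → map (_∷ v) (range n)) (cube n d)

segSum : ∀ {d} → Vec ℤ d → Fin d → Fin d → ℤ
segSum {d} x j k =
  List.foldr ℤ._+_ (+ 0)
    (map (lookup x)
      (filter (λ i → (toℕ j ℕ.≤? toℕ i) ×-dec (toℕ i ℕ.≤? toℕ k)) (allFin d)))

InDilatedSt : (d n : ℕ) → Vec ℤ d → Set
InDilatedSt d n x =
  (∀ (i : Fin d) → (- (+ n)) ℤ.≤ lookup x i × lookup x i ℤ.≤ (+ n))
  × (∀ (j k : Fin d) → j Fin.< k → segSum x j k ℤ.≤ (+ n))

inDilatedSt? : (d n : ℕ) → Decidable (InDilatedSt d n)
inDilatedSt? d n x =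
  FinP.all? (λ i → ((- (+ n)) ℤP.≤? lookup x i) ×-dec (lookup x i ℤP.≤? (+ n)))
  ×-dec FinP.all? (λ j → FinP.all? (λ k → (j FinP.<? k) →-dec (segSum x j k ℤP.≤? (+ n))))

latticeCount : (d n : ℕ) → ℕ
latticeCount d n = length (filter (inDilatedSt? d n) (cube n d))

-- Polynomials over ℚ as coefficient lists [c₀, c₁, ...]

Poly : Set
Poly = List ℚ

eval : Poly → ℚ → ℚ
eval []       x = 0ℚ
eval (c ∷ cs) x = c ℚ.+ x ℚ.* eval cs x

_^_ : ℚ → ℕ → ℚ
x ^ zero  = 1ℚ
x ^ suc k = x ℚ.* (x ^ k)

fromℕ : ℕ → ℚ
fromℕ m = (+ m) ℚ./ 1

IsEhrhartPolynomialOfSt : (d : ℕ) → Poly → Set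
IsEhrhartPolynomialOfSt d p =
  ∀ (n : ℕ) → 1 ℕ.≤ n → eval p (fromℕ n) ≡ fromℕ (latticeCount d n)

magicSum : (d : ℕ) → (Fin (suc d) → ℚ) → ℚ → ℚ
magicSum d a x =
  List.foldr ℚ._+_ 0ℚ
    (map (λ i → a i ℚ.* ((x ^ toℕ i) ℚ.* ((1ℚ ℚ.+ x) ^ (d ℕ.∸ toℕ i)))) (allFin (suc d)))

MagicPositive : (d : ℕ) → Poly → Set
MagicPositive d p =
  (length p ℕ.≤ suc d)
  × Σ (Fin (suc d) → ℚ) (λ a →
      (∀ i → 0ℚ ℚ.≤ a i) × (∀ (x : ℚ) → eval p x ≡ magicSum d a x))

{-# OPTIONS --safe #-}
-- A lattice point x ∷ v lies in n St_d^* iff v does, -n ≤ x and x + s v ≤ n, where s v is the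
-- largest of 0 and the prefix sums of v.  Counting the admissible x for each v, the number C d of
-- lattice points and the sum W d of s over them satisfy C (d + 1) + W d = (2n + 1) C d and
-- W (d + 1) = ½ n (n + 1) C d, hence C (d + 2) = (2n + 1) C (d + 1) - ½ n (n + 1) C d.  With x = n
-- and y = n + 1 this is C (d + 2) = (x + y) C (d + 1) - ½ x y C d, so C d = T d (x , y) for the
-- binary forms with T 0 = 1, T 1 = x + y and the same recurrence.  Its minus sign disappears for
-- A (d + 1) = T (d + 1) - x T d, which satisfies A (d + 2) = y A (d + 1) + ½ x y T d.  So A and T
-- have nonnegative coefficients in the monomials x ^ i y ^ (d - i), and those of T d are the magic
-- coefficients.
module Submission where

open import Defs

module ListProperties where
  open import Level using (Level)
  open import Data.Nat.Base using (ℕ; zero; suc; _+_; s≤s; s≤s⁻¹)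
  open import Data.Nat.Properties using (_≤?_; <⇒≱; m≤m+n)
  open import Data.List.Base using (List; []; _∷_; _++_; map; filter; applyUpTo; upTo)
  open import Data.List.Properties using (filter-++; filter-all; filter-none; ++-identityʳ)
  open import Data.List.Relation.Unary.All as All using (All; []; _∷_)
  open import Data.List.Relation.Unary.All.Properties using (all-upTo; applyUpTo⁺₂)
  open import Data.Bool.Base using (true; false)
  open import Data.Nat.ListAction using (sum)
  open import Function.Base using (_∘_; id)
  open import Relation.Binary.PropositionalEquality using (_≡_; _≗_; refl; cong; cong₂)
  open Relation.Binary.PropositionalEquality.≡-Reasoning
  open import Relation.Nullary using (does)
  open import Relation.Unary using (Pred; Decidable)

  private variable
    a b p : Level
    A : Set a
    B : Set b

  filter-map : {P : Pred B p} (P? : Decidable P) (f : A → B) →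
               filter P? ∘ map f ≗ map f ∘ filter (P? ∘ f)
  filter-map P? f []       = refl
  filter-map P? f (x ∷ xs) with does (P? (f x))
  ... | true  = cong (f x ∷_) (filter-map P? f xs)
  ... | false = filter-map P? f xs

  applyUpTo-++ : (f : ℕ → A) (m k : ℕ) →
                 applyUpTo f (m + k) ≡ applyUpTo f m ++ applyUpTo (f ∘ (m +_)) k
  applyUpTo-++ f zero    k = refl
  applyUpTo-++ f (suc m) k = cong (f 0 ∷_) (applyUpTo-++ (f ∘ suc) m k)

  sum-zero : {xs : List ℕ} → All (_≡ 0) xs → sum xs ≡ 0
  sum-zero []           = refl
  sum-zero (x≡0 ∷ xs≡0) = cong₂ _+_ x≡0 (sum-zero xs≡0)

  filter-≤-upTo : ∀ k t → filter (_≤? k) (upTo (suc k + t)) ≡ upTo (suc k)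
  filter-≤-upTo k t = begin
    filter (_≤? k) (upTo (suc k + t))
      ≡⟨ cong (filter (_≤? k)) (applyUpTo-++ id (suc k) t) ⟩
    filter (_≤? k) (upTo (suc k) ++ applyUpTo (suc k +_) t)
      ≡⟨ filter-++ (_≤? k) (upTo (suc k)) _ ⟩
    filter (_≤? k) (upTo (suc k)) ++ filter (_≤? k) (applyUpTo (suc k +_) t)
      ≡⟨ cong₂ _++_ (filter-all (_≤? k) (All.map s≤s⁻¹ (all-upTo (suc k))))
                    (filter-none (_≤? k) (applyUpTo⁺₂ (suc k +_) t (λ j → <⇒≱ (s≤s (m≤m+n k j))))) ⟩
    upTo (suc k) ++ []
      ≡⟨ ++-identityʳ (upTo (suc k)) ⟩
    upTo (suc k) ∎

module SecondOrderRecurrences where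
  open import Data.Nat.Base using (ℕ; zero; suc)
  open import Data.Product using (_×_; _,_; proj₁)
  open import Relation.Binary.PropositionalEquality using (_≡_; cong₂; trans; sym)

  Solves : ∀ {a} {A : Set a} → (A → A → A) → (ℕ → A) → Set a
  Solves F s = ∀ m → s (suc (suc m)) ≡ F (s (suc m)) (s m)

  solution-unique : ∀ {a} {A : Set a} (F : A → A → A) {s t : ℕ → A} → Solves F s → Solves F t →
                    s 0 ≡ t 0 → s 1 ≡ t 1 → ∀ m → s m ≡ t m
  solution-unique F {s} {t} s-solves t-solves s₀≡t₀ s₁≡t₁ m = proj₁ (agree m)
    where
    agree : ∀ m → s m ≡ t m × s (suc m) ≡ t (suc m)
    agree zero    = s₀≡t₀ , s₁≡t₁
    agree (suc m) with sₘ≡tₘ , sₘ₊₁≡tₘ₊₁ ← agree m =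
      sₘ₊₁≡tₘ₊₁ , trans (s-solves m) (trans (cong₂ F sₘ₊₁≡tₘ₊₁ sₘ≡tₘ) (sym (t-solves m)))

module HomogeneousForms where
  open import Data.Nat.Base using (ℕ; zero; suc; _∸_)
  open import Data.Fin.Base using (Fin; zero; suc; toℕ)
  open import Data.List.Base as List using (tabulate)
  open import Data.List.Properties using (map-tabulate)
  open import Data.Product using (_×_; _,_; proj₁; proj₂)
  open import Data.Rational.Base using (ℚ; 0ℚ; 1ℚ; ½; _+_; _*_; _-_; _≤_; NonNegative)
  import Data.Rational.Properties as ℚ
  open import Data.Vec.Base using (Vec; []; _∷_; _∷ʳ_; zipWith; map; lookup; toList)
  open import Data.Vec.Relation.Unary.All as All using (All; []; _∷_)
  import Data.Vec.Relation.Unary.All.Properties as Allₚ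
  open import Algebra.Bundles using (Ring)
  open import Algebra.Properties.Semiring.Sum (Ring.semiring ℚ.+-*-ring) using (sum; *-distribˡ-sum; sum-cong-≗)
  open import Data.Rational.Solver using (module +-*-Solver)
  open import Relation.Binary.PropositionalEquality
  open +-*-Solver using (solve; _:=_; con; _:+_; _:*_; _:-_)
  open SecondOrderRecurrences using (Solves)
  open ≡-Reasoning

  Form : ℕ → Set
  Form k = Vec ℚ (suc k)

  -- Entry i of a form of degree k is the coefficient of x ^ i * y ^ (k - i).
  ⟦_⟧ : ∀ {k} → Form k → ℚ → ℚ → ℚ
  ⟦_⟧ {zero}  (a ∷ []) x y = a
  ⟦_⟧ {suc k} (a ∷ c)  x y = a * y ^ suc k + x * ⟦ c ⟧ x y

  infixr 7 x·_ y·_ _⊛_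
  infixl 6 _⊕_

  x·_ y·_ : ∀ {k} → Form k → Form (suc k)
  x· c = 0ℚ ∷ c
  y· c = c ∷ʳ 0ℚ

  _⊕_ : ∀ {k} → Form k → Form k → Form k
  _⊕_ = zipWith _+_

  _⊛_ : ∀ {k} → ℚ → Form k → Form k
  q ⊛ c = map (q *_) c

  ⟦x·⟧ : ∀ {k} (c : Form k) x y → ⟦ x· c ⟧ x y ≡ x * ⟦ c ⟧ x y
  ⟦x·⟧ {k} c x y = solve 3 (λ Y x h → con 0ℚ :* Y :+ x :* h := x :* h) refl (y ^ suc k) x (⟦ c ⟧ x y)

  ⟦y·⟧ : ∀ {k} (c : Form k) x y → ⟦ y· c ⟧ x y ≡ y * ⟦ c ⟧ x y
  ⟦y·⟧ {zero} (a ∷ []) x y = solve 3 (λ a x y → a :* (y :* con 1ℚ) :+ x :* con 0ℚ := y :* a) refl a x y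
  ⟦y·⟧ {suc k} (a ∷ c) x y = begin
    a * y ^ suc (suc k) + x * ⟦ y· c ⟧ x y
      ≡⟨ cong (λ h → a * y ^ suc (suc k) + x * h) (⟦y·⟧ c x y) ⟩
    a * (y * y ^ suc k) + x * (y * ⟦ c ⟧ x y)
      ≡⟨ solve 5 (λ a x y Y h → a :* (y :* Y) :+ x :* (y :* h) := y :* (a :* Y :+ x :* h)) refl
               a x y (y ^ suc k) (⟦ c ⟧ x y) ⟩
    y * ⟦ a ∷ c ⟧ x y ∎

  ⟦⊕⟧ : ∀ {k} (c e : Form k) x y → ⟦ c ⊕ e ⟧ x y ≡ ⟦ c ⟧ x y + ⟦ e ⟧ x y
  ⟦⊕⟧ {zero}  (a ∷ []) (b ∷ []) x y = refl
  ⟦⊕⟧ {suc k} (a ∷ c)  (b ∷ e)  x y = begin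
    (a + b) * Y + x * ⟦ c ⊕ e ⟧ x y
      ≡⟨ cong (λ h → (a + b) * Y + x * h) (⟦⊕⟧ c e x y) ⟩
    (a + b) * Y + x * (⟦ c ⟧ x y + ⟦ e ⟧ x y)
      ≡⟨ solve 6 (λ a b x Y h g → (a :+ b) :* Y :+ x :* (h :+ g) := (a :* Y :+ x :* h) :+ (b :* Y :+ x :* g)) refl
               a b x Y (⟦ c ⟧ x y) (⟦ e ⟧ x y) ⟩
    ⟦ a ∷ c ⟧ x y + ⟦ b ∷ e ⟧ x y ∎
    where
    Y = y ^ suc k

  ⟦⊛⟧ : ∀ {k} q (c : Form k) x y → ⟦ q ⊛ c ⟧ x y ≡ q * ⟦ c ⟧ x y
  ⟦⊛⟧ {zero}  q (a ∷ []) x y = refl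
  ⟦⊛⟧ {suc k} q (a ∷ c)  x y = begin
    (q * a) * Y + x * ⟦ q ⊛ c ⟧ x y
      ≡⟨ cong (λ h → (q * a) * Y + x * h) (⟦⊛⟧ q c x y) ⟩
    (q * a) * Y + x * (q * ⟦ c ⟧ x y)
      ≡⟨ solve 5 (λ q a x Y h → (q :* a) :* Y :+ x :* (q :* h) := q :* (a :* Y :+ x :* h)) refl q a x Y (⟦ c ⟧ x y) ⟩
    q * ⟦ a ∷ c ⟧ x y ∎
    where
    Y = y ^ suc k

  NonNegativeForm : ∀ {k} → Form k → Set
  NonNegativeForm = All (0ℚ ≤_)

  x·-nonNegative : ∀ {k} {c : Form k} → NonNegativeForm c → NonNegativeForm (x· c)
  x·-nonNegative c≥0 = ℚ.≤-refl ∷ c≥0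

  y·-nonNegative : ∀ {k} {c : Form k} → NonNegativeForm c → NonNegativeForm (y· c)
  y·-nonNegative (a≥0 ∷ [])            = a≥0 ∷ ℚ.≤-refl ∷ []
  y·-nonNegative (a≥0 ∷ c≥0@(_ ∷ _)) = a≥0 ∷ y·-nonNegative c≥0

  ⊕-nonNegative : ∀ {k} {c e : Form k} → NonNegativeForm c → NonNegativeForm e → NonNegativeForm (c ⊕ e)
  ⊕-nonNegative (a≥0 ∷ [])            (b≥0 ∷ [])  = ℚ.+-mono-≤ a≥0 b≥0 ∷ []
  ⊕-nonNegative (a≥0 ∷ c≥0@(_ ∷ _)) (b≥0 ∷ e≥0) = ℚ.+-mono-≤ a≥0 b≥0 ∷ ⊕-nonNegative c≥0 e≥0

  ⊛-nonNegative : ∀ {k} q .{{_ : NonNegative q}} {c : Form k} → NonNegativeForm c → NonNegativeForm (q ⊛ c)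
  ⊛-nonNegative q c≥0 = Allₚ.map⁺ (All.map q*-nonNegative c≥0)
    where
    q*-nonNegative : ∀ {a} → 0ℚ ≤ a → 0ℚ ≤ q * a
    q*-nonNegative {a} a≥0 = subst (_≤ q * a) (ℚ.*-zeroʳ q) (ℚ.*-monoˡ-≤-nonNeg q a≥0)

  one : Form 0
  one = 1ℚ ∷ []

  -- (A (m + 1) , T m) ↦ (A (m + 2) , T (m + 1))
  stasheffStep : ∀ {m} → Form (suc m) × Form m → Form (suc (suc m)) × Form (suc m)
  stasheffStep (a , t) = y· a ⊕ ½ ⊛ x· y· t , a ⊕ x· t

  stasheffPair : (m : ℕ) → Form (suc m) × Form m
  stasheffPair zero    = y· one , one
  stasheffPair (suc m) = stasheffStep (stasheffPair m)

  stasheffForm : (m : ℕ) → Form m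
  stasheffForm m = proj₂ (stasheffPair m)

  stasheffPair-nonNegative : ∀ m →
    NonNegativeForm (proj₁ (stasheffPair m)) × NonNegativeForm (proj₂ (stasheffPair m))
  stasheffPair-nonNegative zero    = y·-nonNegative one≥0 , one≥0
    where
    one≥0 : NonNegativeForm one
    one≥0 = ℚ.nonNegative⁻¹ 1ℚ ∷ []
  stasheffPair-nonNegative (suc m) with a≥0 , t≥0 ← stasheffPair-nonNegative m =
    ⊕-nonNegative (y·-nonNegative a≥0) (⊛-nonNegative ½ (x·-nonNegative (y·-nonNegative t≥0))) ,
    ⊕-nonNegative a≥0 (x·-nonNegative t≥0)

  ⟦stasheffForm-1⟧ : ∀ x y → ⟦ stasheffForm 1 ⟧ x y ≡ x + y
  ⟦stasheffForm-1⟧ =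
    solve 2 (λ x y → (con 1ℚ :+ con 0ℚ) :* (y :* con 1ℚ) :+ x :* (con 0ℚ :+ con 1ℚ) := x :+ y) refl

  stasheffRecurrence : ℚ → ℚ → ℚ → ℚ → ℚ
  stasheffRecurrence x y c₁ c₀ = (x + y) * c₁ - ½ * (x * y) * c₀

  ⟦stasheffForm⟧-solves : ∀ x y → Solves (stasheffRecurrence x y) (λ m → ⟦ stasheffForm m ⟧ x y)
  ⟦stasheffForm⟧-solves x y m = begin
    ⟦ a′ ⊕ x· t′ ⟧ x y
      ≡⟨ ⟦⊕⟧ a′ (x· t′) x y ⟩
    ⟦ a′ ⟧ x y + ⟦ x· t′ ⟧ x y
      ≡⟨ cong₂ _+_ ⟦a′⟧ (trans (⟦x·⟧ t′ x y) (cong (x *_) ⟦t′⟧)) ⟩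
    (y * A + ½ * (x * (y * T))) + x * (A + x * T)
      ≡⟨ solve 4 (λ x y A T → (y :* A :+ con ½ :* (x :* (y :* T))) :+ x :* (A :+ x :* T)
                            := (x :+ y) :* (A :+ x :* T) :- con ½ :* (x :* y) :* T) refl x y A T ⟩
    (x + y) * (A + x * T) - ½ * (x * y) * T
      ≡⟨ cong (λ h → (x + y) * h - ½ * (x * y) * T) (sym ⟦t′⟧) ⟩
    (x + y) * ⟦ t′ ⟧ x y - ½ * (x * y) * T ∎
    where
    a = proj₁ (stasheffPair m)
    t = proj₂ (stasheffPair m)
    a′ = y· a ⊕ ½ ⊛ x· y· t
    t′ = a ⊕ x· t
    A = ⟦ a ⟧ x y
    T = ⟦ t ⟧ x y
    ⟦a′⟧ : ⟦ a′ ⟧ x y ≡ y * A + ½ * (x * (y * T))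
    ⟦a′⟧ = begin
      ⟦ y· a ⊕ ½ ⊛ x· y· t ⟧ x y
        ≡⟨ ⟦⊕⟧ (y· a) (½ ⊛ x· y· t) x y ⟩
      ⟦ y· a ⟧ x y + ⟦ ½ ⊛ x· y· t ⟧ x y
        ≡⟨ cong₂ _+_ (⟦y·⟧ a x y) (⟦⊛⟧ ½ (x· y· t) x y) ⟩
      y * A + ½ * ⟦ x· y· t ⟧ x y
        ≡⟨ cong (λ h → y * A + ½ * h) (trans (⟦x·⟧ (y· t) x y) (cong (x *_) (⟦y·⟧ t x y))) ⟩
      y * A + ½ * (x * (y * T)) ∎
    ⟦t′⟧ : ⟦ t′ ⟧ x y ≡ A + x * T
    ⟦t′⟧ = trans (⟦⊕⟧ a (x· t) x y) (cong (A +_) (⟦x·⟧ t x y))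

  binomial : (k : ℕ) → Form k
  binomial zero    = one
  binomial (suc k) = y· binomial k ⊕ x· binomial k

  ⟦binomial⟧ : ∀ k x → ⟦ binomial k ⟧ x 1ℚ ≡ (1ℚ + x) ^ k
  ⟦binomial⟧ zero    x = refl
  ⟦binomial⟧ (suc k) x = begin
    ⟦ y· b ⊕ x· b ⟧ x 1ℚ            ≡⟨ ⟦⊕⟧ (y· b) (x· b) x 1ℚ ⟩
    ⟦ y· b ⟧ x 1ℚ + ⟦ x· b ⟧ x 1ℚ   ≡⟨ cong₂ _+_ (⟦y·⟧ b x 1ℚ) (⟦x·⟧ b x 1ℚ) ⟩
    1ℚ * B + x * B
      ≡⟨ solve 2 (λ x B → con 1ℚ :* B :+ x :* B := (con 1ℚ :+ x) :* B) refl x B ⟩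
    (1ℚ + x) * B                    ≡⟨ cong ((1ℚ + x) *_) (⟦binomial⟧ k x) ⟩
    (1ℚ + x) ^ suc k                ∎
    where
    b = binomial k
    B = ⟦ b ⟧ x 1ℚ

  expand : ∀ {k} → Form k → Form k
  expand {zero}  c       = c
  expand {suc k} (a ∷ c) = a ⊛ binomial (suc k) ⊕ x· expand c

  ⟦expand⟧ : ∀ {k} (c : Form k) x → ⟦ expand c ⟧ x 1ℚ ≡ ⟦ c ⟧ x (1ℚ + x)
  ⟦expand⟧ {zero}  (a ∷ []) x = refl
  ⟦expand⟧ {suc k} (a ∷ c)  x = begin
    ⟦ a ⊛ binomial (suc k) ⊕ x· expand c ⟧ x 1ℚ
      ≡⟨ ⟦⊕⟧ (a ⊛ binomial (suc k)) (x· expand c) x 1ℚ ⟩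
    ⟦ a ⊛ binomial (suc k) ⟧ x 1ℚ + ⟦ x· expand c ⟧ x 1ℚ
      ≡⟨ cong₂ _+_ (⟦⊛⟧ a (binomial (suc k)) x 1ℚ) (⟦x·⟧ (expand c) x 1ℚ) ⟩
    a * ⟦ binomial (suc k) ⟧ x 1ℚ + x * ⟦ expand c ⟧ x 1ℚ
      ≡⟨ cong₂ (λ B E → a * B + x * E) (⟦binomial⟧ (suc k) x) (⟦expand⟧ c x) ⟩
    ⟦ a ∷ c ⟧ x (1ℚ + x) ∎

  1^k≡1 : ∀ k → 1ℚ ^ k ≡ 1ℚ
  1^k≡1 zero    = refl
  1^k≡1 (suc k) = trans (ℚ.*-identityˡ (1ℚ ^ k)) (1^k≡1 k)

  eval-toList : ∀ {k} (c : Form k) x → eval (toList c) x ≡ ⟦ c ⟧ x 1ℚ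
  eval-toList {zero}  (a ∷ []) x = trans (cong (a +_) (ℚ.*-zeroʳ x)) (ℚ.+-identityʳ a)
  eval-toList {suc k} (a ∷ c)  x = cong₂ (λ u h → u + x * h)
    (sym (trans (cong (a *_) (1^k≡1 (suc k))) (ℚ.*-identityʳ a))) (eval-toList c x)

  foldr-tabulate : ∀ {k} (f : Fin k → ℚ) → List.foldr _+_ 0ℚ (tabulate f) ≡ sum f
  foldr-tabulate {zero}  f = refl
  foldr-tabulate {suc k} f = cong (f zero +_) (foldr-tabulate (λ i → f (suc i)))

  sum-monomials : ∀ {k} (c : Form k) x y →
    sum (λ i → lookup c i * (x ^ toℕ i * y ^ (k ∸ toℕ i))) ≡ ⟦ c ⟧ x y
  sum-monomials {zero}  (a ∷ []) x y = solve 1 (λ a → a :* (con 1ℚ :* con 1ℚ) :+ con 0ℚ := a) refl a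
  sum-monomials {suc k} (a ∷ c)  x y = begin
    a * (1ℚ * Y) + sum (λ i → lookup c i * ((x * x ^ toℕ i) * y ^ (k ∸ toℕ i)))
      ≡⟨ cong₂ _+_ (cong (a *_) (ℚ.*-identityˡ Y)) (sum-cong-≗ λ i →
           solve 4 (λ c x X Y → c :* ((x :* X) :* Y) := x :* (c :* (X :* Y))) refl
                   (lookup c i) x (x ^ toℕ i) (y ^ (k ∸ toℕ i))) ⟩
    a * Y + sum (λ i → x * g i)
      ≡⟨ cong (a * Y +_) (sym (*-distribˡ-sum x g)) ⟩
    a * Y + x * sum g
      ≡⟨ cong (λ s → a * Y + x * s) (sum-monomials c x y) ⟩
    ⟦ a ∷ c ⟧ x y ∎
    where
    Y = y ^ suc k
    g : Fin (suc k) → ℚ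
    g i = lookup c i * (x ^ toℕ i * y ^ (k ∸ toℕ i))

  magicSum-⟦⟧ : ∀ k (c : Form k) x → magicSum k (lookup c) x ≡ ⟦ c ⟧ x (1ℚ + x)
  magicSum-⟦⟧ k c x = begin
    magicSum k (lookup c) x       ≡⟨ cong (List.foldr _+_ 0ℚ) (map-tabulate (λ i → i) f) ⟩
    List.foldr _+_ 0ℚ (tabulate f) ≡⟨ foldr-tabulate f ⟩
    sum f                          ≡⟨ sum-monomials c x (1ℚ + x) ⟩
    ⟦ c ⟧ x (1ℚ + x)               ∎
    where
    f : Fin (suc k) → ℚ
    f i = lookup c i * (x ^ toℕ i * (1ℚ + x) ^ (k ∸ toℕ i))

module AdmissiblePoints where
  open import Data.Nat.Base as ℕ using (ℕ; zero; suc; z≤n; s≤s; s≤s⁻¹; _∸_)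
  import Data.Nat.Properties as ℕ
  open import Data.Integer.Base using (ℤ; +_; -[1+_]; -_; _+_; _≤_; _⊖_; -≤+)
  open import Data.Integer.Properties as ℤ using (_≤?_)
  open import Data.Fin.Base using (Fin; zero; suc; toℕ; _<_)
  open import Data.List.Base using (filter; allFin; tabulate; foldr; map)
  open import Data.List.Properties using (map-tabulate; map-∘; filter-≐; filter-none)
  import Data.List.Relation.Unary.All as ListAll
  open import Data.Product using (_×_; _,_; proj₁; proj₂; ∃-syntax)
  open import Data.Sum using (_⊎_; inj₁; inj₂)
  open import Data.Unit.Base using (⊤; tt)
  open import Data.Vec.Base using (Vec; []; _∷_; lookup)
  open import Function.Base using (_∘_; id)
  open import Level using (0ℓ)
  open import Relation.Binary.PropositionalEquality
  open import Relation.Nullary using (yes)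
  open import Relation.Nullary.Decidable using (_×-dec_)
  open import Relation.Unary using (Pred; Decidable; _≐_)
  open import Relation.Unary.Properties using (∅?)
  open ListProperties using (filter-map)
  open ≡-Reasoning

  _⁺ : ℤ → ℕ
  (+ m)      ⁺ = m
  -[1+ m ] ⁺ = 0

  i≤i⁺ : ∀ i → i ≤ + i ⁺
  i≤i⁺ (+ m)      = ℤ.≤-refl
  i≤i⁺ -[1+ m ] = -≤+

  i⁺≡0⊎+i⁺≡i : ∀ i → i ⁺ ≡ 0 ⊎ + i ⁺ ≡ i
  i⁺≡0⊎+i⁺≡i (+ m)      = inj₂ refl
  i⁺≡0⊎+i⁺≡i -[1+ m ] = inj₁ refl

  i≤+m⇒i⁺≤m : ∀ {i m} → i ≤ + m → i ⁺ ℕ.≤ m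
  i≤+m⇒i⁺≤m {+ _}      i≤m = ℤ.drop‿+≤+ i≤m
  i≤+m⇒i⁺≤m { -[1+ _ ]} _  = z≤n

  [-+m]⁺≡0 : ∀ m → (- + m) ⁺ ≡ 0
  [-+m]⁺≡0 zero    = refl
  [-+m]⁺≡0 (suc m) = refl

  [m⊖n]⁺≡m∸n : ∀ m n → (m ⊖ n) ⁺ ≡ m ∸ n
  [m⊖n]⁺≡m∸n m n with ℕ.≤-<-connex n m
  ... | inj₁ n≤m = cong _⁺ (ℤ.⊖-≥ n≤m)
  ... | inj₂ m<n = trans (cong _⁺ (ℤ.⊖-< m<n)) (trans ([-+m]⁺≡0 (n ∸ m)) (sym (ℕ.m≤n⇒m∸n≡0 (ℕ.<⇒≤ m<n))))

  sumOver : ∀ {d} {P : Pred (Fin d) 0ℓ} → Decidable P → Vec ℤ d → ℤ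
  sumOver P? x = foldr _+_ (+ 0) (map (lookup x) (filter P? (allFin _)))

  -- allFin (suc d) is zero ∷ tabulate suc, so this is the tail of sumOver P? (x ∷ v).
  sumOver-tail : ∀ {d} {P : Pred (Fin (suc d)) 0ℓ} {Q : Pred (Fin d) 0ℓ} (P? : Decidable P) (Q? : Decidable Q) →
                 (P ∘ suc) ≐ Q → ∀ x v →
                 foldr _+_ (+ 0) (map (lookup (x ∷ v)) (filter P? (tabulate suc))) ≡ sumOver Q? v
  sumOver-tail {d} P? Q? P∘suc≐Q x v = cong (foldr _+_ (+ 0)) (begin
    map (lookup (x ∷ v)) (filter P? (tabulate suc))
      ≡⟨ cong (map (lookup (x ∷ v)) ∘ filter P?) (map-tabulate id suc) ⟨
    map (lookup (x ∷ v)) (filter P? (map suc (allFin d)))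
      ≡⟨ cong (map (lookup (x ∷ v))) (filter-map P? suc (allFin d)) ⟩
    map (lookup (x ∷ v)) (map suc (filter (P? ∘ suc) (allFin d)))
      ≡⟨ cong (map (lookup (x ∷ v)) ∘ map suc) (filter-≐ (P? ∘ suc) Q? P∘suc≐Q (allFin d)) ⟩
    map (lookup (x ∷ v)) (map suc (filter Q? (allFin d)))
      ≡⟨ map-∘ _ ⟨
    map (lookup v) (filter Q? (allFin d)) ∎)

  prefixSum : ∀ {d} → Vec ℤ d → Fin d → ℤ
  prefixSum v@(_ ∷ _) k = segSum v zero k

  -- segSum x j k unfolds to sumOver (inSegment? (toℕ j) (toℕ k)) x.
  inSegment? : ∀ {d} (a b : ℕ) → Decidable (λ (i : Fin d) → a ℕ.≤ toℕ i × toℕ i ℕ.≤ b)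
  inSegment? a b i = (a ℕ.≤? toℕ i) ×-dec (toℕ i ℕ.≤? b)

  segSum-suc-suc : ∀ {d} x (v : Vec ℤ d) j k → segSum (x ∷ v) (suc j) (suc k) ≡ segSum v j k
  segSum-suc-suc x v j k = sumOver-tail (inSegment? (suc (toℕ j)) (suc (toℕ k))) (inSegment? (toℕ j) (toℕ k))
    ((λ (p , q) → s≤s⁻¹ p , s≤s⁻¹ q) , (λ (p , q) → s≤s p , s≤s q)) x v

  segSum-zero-suc : ∀ {d} x (v : Vec ℤ d) k → segSum (x ∷ v) zero (suc k) ≡ x + prefixSum v k
  segSum-zero-suc x v@(_ ∷ _) k = cong (_+_ x) (sumOver-tail (inSegment? 0 (suc (toℕ k))) (inSegment? 0 (toℕ k))
    ((λ (_ , q) → z≤n , s≤s⁻¹ q) , (λ (_ , q) → z≤n , s≤s q)) x v)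

  segSum-zero-zero : ∀ {d} x (v : Vec ℤ d) → segSum (x ∷ v) zero zero ≡ x
  segSum-zero-zero {d} x v = begin
    segSum (x ∷ v) zero zero
      ≡⟨ cong (_+_ x) (sumOver-tail (inSegment? 0 0) ∅? ((λ ()) ∘ proj₂ , λ ()) x v) ⟩
    x + sumOver ∅? v
      ≡⟨ cong (λ l → x + foldr _+_ (+ 0) (map (lookup v) l)) (filter-none ∅? (ListAll.universal (λ _ ()) (allFin d))) ⟩
    x + + 0
      ≡⟨ ℤ.+-identityʳ x ⟩
    x ∎

  -- The largest of 0 and the prefix sums x₁ + ⋯ + xₖ.
  maxPrefixSum : ∀ {d} → Vec ℤ d → ℕ
  maxPrefixSum []      = 0
  maxPrefixSum (x ∷ v) = (x + + maxPrefixSum v) ⁺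

  prefixSum≤maxPrefixSum : ∀ {d} (v : Vec ℤ d) k → prefixSum v k ≤ + maxPrefixSum v
  prefixSum≤maxPrefixSum (y ∷ w) zero    = subst (_≤ + maxPrefixSum (y ∷ w)) (sym (segSum-zero-zero y w))
    (ℤ.≤-trans (ℤ.i≤i+j y (+ maxPrefixSum w)) (i≤i⁺ _))
  prefixSum≤maxPrefixSum (y ∷ w) (suc k) = subst (_≤ + maxPrefixSum (y ∷ w)) (sym (segSum-zero-suc y w k))
    (ℤ.≤-trans (ℤ.+-monoʳ-≤ y (prefixSum≤maxPrefixSum w k)) (i≤i⁺ _))

  maxPrefixSum-attained : ∀ {d} (v : Vec ℤ d) → maxPrefixSum v ≡ 0 ⊎ ∃[ k ] + maxPrefixSum v ≡ prefixSum v k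
  maxPrefixSum-attained []      = inj₁ refl
  maxPrefixSum-attained (y ∷ w) with i⁺≡0⊎+i⁺≡i (y + + maxPrefixSum w) | maxPrefixSum-attained w
  ... | inj₁ y∷w≡0 | _            = inj₁ y∷w≡0
  ... | inj₂ y∷w≡  | inj₁ w≡0     = inj₂ (zero , (begin
    + maxPrefixSum (y ∷ w)   ≡⟨ y∷w≡ ⟩
    y + + maxPrefixSum w     ≡⟨ cong (λ m → y + + m) w≡0 ⟩
    y + + 0                  ≡⟨ ℤ.+-identityʳ y ⟩
    y                        ≡⟨ segSum-zero-zero y w ⟨
    segSum (y ∷ w) zero zero ∎))
  ... | inj₂ y∷w≡  | inj₂ (k , w≡) = inj₂ (suc k , (begin
    + maxPrefixSum (y ∷ w)      ≡⟨ y∷w≡ ⟩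
    y + + maxPrefixSum w        ≡⟨ cong (_+_ y) w≡ ⟩
    y + prefixSum w k           ≡⟨ segSum-zero-suc y w k ⟨
    segSum (y ∷ w) zero (suc k) ∎))

  Fits : ℕ → ℕ → ℤ → Set
  Fits n t x = - + n ≤ x × x + + t ≤ + n

  fits? : ∀ n t → Decidable (Fits n t)
  fits? n t x = (- + n ≤? x) ×-dec (x + + t ≤? + n)

  Admissible : ℕ → ∀ {d} → Vec ℤ d → Set
  Admissible n []      = ⊤
  Admissible n (x ∷ v) = Admissible n v × Fits n (maxPrefixSum v) x

  admissible? : ∀ n {d} → Decidable (Admissible n {d})
  admissible? n []      = yes tt
  admissible? n (x ∷ v) = admissible? n v ×-dec fits? n (maxPrefixSum v) x

  admissible⇒maxPrefixSum≤ : ∀ {n d} {v : Vec ℤ d} → Admissible n v → maxPrefixSum v ℕ.≤ n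
  admissible⇒maxPrefixSum≤ {v = []}    _           = z≤n
  admissible⇒maxPrefixSum≤ {v = _ ∷ _} (_ , _ , hi) = i≤+m⇒i⁺≤m hi

  module _ {n : ℕ} where

    inDilatedSt⇒admissible : ∀ {d} (v : Vec ℤ d) → InDilatedSt d n v → Admissible n v
    inDilatedSt⇒admissible []      _           = tt
    inDilatedSt⇒admissible (x ∷ v) (box , seg) =
      inDilatedSt⇒admissible v (box ∘ suc , seg-tail) , proj₁ (box zero) , bound (maxPrefixSum-attained v)
      where
      seg-tail : ∀ j k → j < k → segSum v j k ≤ + n
      seg-tail j k j<k = subst (_≤ + n) (segSum-suc-suc x v j k) (seg (suc j) (suc k) (s≤s j<k))
      bound : maxPrefixSum v ≡ 0 ⊎ ∃[ k ] + maxPrefixSum v ≡ prefixSum v k → x + + maxPrefixSum v ≤ + n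
      bound (inj₁ v≡0)      = subst (_≤ + n) (trans (sym (ℤ.+-identityʳ x)) (cong (λ m → x + + m) (sym v≡0)))
                                (proj₂ (box zero))
      bound (inj₂ (k , v≡)) = subst (_≤ + n) (trans (segSum-zero-suc x v k) (cong (_+_ x) (sym v≡)))
                                (seg zero (suc k) (s≤s z≤n))

    admissible⇒inDilatedSt : ∀ {d} (v : Vec ℤ d) → Admissible n v → InDilatedSt d n v
    admissible⇒inDilatedSt []      _                = (λ ()) , (λ ())
    admissible⇒inDilatedSt (x ∷ v) (adm , lo , hi) = box , seg
      where
      ih = admissible⇒inDilatedSt v adm
      box : ∀ i → - + n ≤ lookup (x ∷ v) i × lookup (x ∷ v) i ≤ + n
      box zero    = lo , ℤ.≤-trans (ℤ.i≤i+j x (+ maxPrefixSum v)) hi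
      box (suc i) = proj₁ ih i
      seg : ∀ j k → j < k → segSum (x ∷ v) j k ≤ + n
      seg zero    (suc k) _         = subst (_≤ + n) (sym (segSum-zero-suc x v k))
                                        (ℤ.≤-trans (ℤ.+-monoʳ-≤ x (prefixSum≤maxPrefixSum v k)) hi)
      seg (suc j) (suc k) (s≤s j<k) = subst (_≤ + n) (sym (segSum-suc-suc x v j k)) (proj₂ ih j k j<k)

    inDilatedSt≐admissible : ∀ {d} → InDilatedSt d n ≐ Admissible n
    inDilatedSt≐admissible = (λ {v} → inDilatedSt⇒admissible v) , (λ {v} → admissible⇒inDilatedSt v)

module Counting where
  open import Data.Nat.Base using (ℕ; zero; suc; _+_; _*_; _∸_; _≤_; z≤n)
  open import Data.Nat.Properties as ℕ using (_≤?_)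
  open import Data.Nat.ListAction using (sum)
  open import Data.Nat.ListAction.Properties using (sum-++)
  open import Data.Nat.Tactic.RingSolver using (solve-∀)
  open import Data.Integer.Base as ℤ using (ℤ; +_; -_; +≤+)
  import Data.Integer.Properties as ℤ
  import Data.Integer.Tactic.RingSolver as ℤ-Ring
  open import Data.List.Base using (List; []; _∷_; [_]; _++_; map; filter; concatMap; length; upTo; applyUpTo)
  open import Data.List.Properties
    using ( filter-++; filter-≐; filter-none; filter-accept; filter-reject
          ; length-++; length-map; length-upTo; map-++; map-∘; map-cong; map-id; map-upTo; upTo-∷ʳ)
  open import Data.List.Relation.Unary.All as All using (All; []; _∷_)
  open import Data.List.Relation.Unary.All.Properties using (applyUpTo⁺₁; all-filter)
  open import Data.Product using (_×_; _,_; proj₁; proj₂)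
  open import Data.Vec.Base using (Vec; _∷_)
  open import Function.Base using (_∘_)
  open import Relation.Binary.PropositionalEquality
    using (_≡_; refl; sym; trans; cong; cong₂; subst; subst₂; module ≡-Reasoning)
  open import Relation.Nullary using (Dec; yes; no; ¬_)
  open import Relation.Unary using (_≐_)
  open ListProperties
  open AdmissiblePoints
  open ≡-Reasoning

  triangle : ℕ → ℕ
  triangle n = sum (upTo (suc n))

  2*triangle : ∀ n → 2 * triangle n ≡ n * suc n
  2*triangle zero    = refl
  2*triangle (suc n) = begin
    2 * sum (upTo (suc (suc n)))             ≡⟨ cong (λ l → 2 * sum l) (upTo-∷ʳ (suc n)) ⟨
    2 * sum (upTo (suc n) ++ [ suc n ])      ≡⟨ cong (2 *_) (sum-++ (upTo (suc n)) [ suc n ]) ⟩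
    2 * (triangle n + (suc n + 0))           ≡⟨ distrib (triangle n) n ⟩
    2 * triangle n + 2 * suc n               ≡⟨ cong (_+ 2 * suc n) (2*triangle n) ⟩
    n * suc n + 2 * suc n                    ≡⟨ factor n ⟩
    suc n * suc (suc n)                      ∎
    where
    distrib : ∀ T n → 2 * (T + (suc n + 0)) ≡ 2 * T + 2 * suc n
    distrib = solve-∀
    factor : ∀ n → n * suc n + 2 * suc n ≡ suc n * suc (suc n)
    factor = solve-∀

  -- Writing n = r + t keeps truncated subtraction out of the index bounds below.
  module _ (r t : ℕ) where

    point : ℕ → ℤ
    point i = + i ℤ.- + (r + t)

    point+t : ∀ i → point i ℤ.+ + t ≡ + i ℤ.- + r
    point+t i = trans (cong (λ z → + i ℤ.- z ℤ.+ + t) (ℤ.pos-+ r t)) ([a-[b+c]]+c≡a-b (+ i) (+ r) (+ t))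
      where
      [a-[b+c]]+c≡a-b : ∀ a b c → a ℤ.- (b ℤ.+ c) ℤ.+ c ≡ a ℤ.- b
      [a-[b+c]]+c≡a-b = ℤ-Ring.solve-∀

    fits-point : (Fits (r + t) t ∘ point) ≐ (_≤ (r + t) + r)
    fits-point = (λ {i} → upper⇒≤ i ∘ proj₂) , (λ {i} i≤ → lower i , ≤⇒upper i i≤)
      where
      n = r + t
      [a-b]+b≡a : ∀ a b → a ℤ.- b ℤ.+ b ≡ a
      [a-b]+b≡a = ℤ-Ring.solve-∀
      [a+b]-b≡a : ∀ a b → a ℤ.+ b ℤ.- b ≡ a
      [a+b]-b≡a = ℤ-Ring.solve-∀
      upper⇒≤ : ∀ i → point i ℤ.+ + t ℤ.≤ + n → i ≤ n + r
      upper⇒≤ i upper = ℤ.drop‿+≤+ (subst₂ ℤ._≤_ ([a-b]+b≡a (+ i) (+ r)) (sym (ℤ.pos-+ n r))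
        (ℤ.+-monoˡ-≤ (+ r) (subst (ℤ._≤ + n) (point+t i) upper)))
      lower : ∀ i → - + n ℤ.≤ point i
      lower i = subst (ℤ._≤ point i) (ℤ.+-identityˡ (- + n)) (ℤ.+-monoˡ-≤ (- + n) (+≤+ z≤n))
      ≤⇒upper : ∀ i → i ≤ n + r → point i ℤ.+ + t ℤ.≤ + n
      ≤⇒upper i i≤ = subst₂ ℤ._≤_ (sym (point+t i))
        (trans (cong (ℤ._- + r) (ℤ.pos-+ n r)) ([a+b]-b≡a (+ n) (+ r))) (ℤ.+-monoˡ-≤ (- + r) (+≤+ i≤))

    filter-fits-range : filter (fits? (r + t) t) (range (r + t)) ≡ map point (upTo (suc ((r + t) + r)))
    filter-fits-range = begin
      filter (fits? n t) (map point (upTo (suc (2 * n))))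
        ≡⟨ cong (filter (fits? n t) ∘ map point ∘ upTo) (length-identity r t) ⟩
      filter (fits? n t) (map point (upTo (suc (n + r) + t)))
        ≡⟨ filter-map (fits? n t) point _ ⟩
      map point (filter (fits? n t ∘ point) (upTo (suc (n + r) + t)))
        ≡⟨ cong (map point) (filter-≐ (fits? n t ∘ point) (_≤? n + r) fits-point _) ⟩
      map point (filter (_≤? n + r) (upTo (suc (n + r) + t)))
        ≡⟨ cong (map point) (filter-≤-upTo (n + r) t) ⟩
      map point (upTo (suc (n + r))) ∎
      where
      n = r + t
      length-identity : ∀ r t → suc (2 * (r + t)) ≡ suc ((r + t) + r) + t
      length-identity = solve-∀

    length-fits : length (filter (fits? (r + t) t) (range (r + t))) + t ≡ suc (2 * (r + t))
    length-fits = begin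
      length (filter (fits? n t) (range n)) + t
        ≡⟨ cong (λ l → length l + t) filter-fits-range ⟩
      length (map point (upTo (suc (n + r)))) + t
        ≡⟨ cong (_+ t) (trans (length-map point (upTo (suc (n + r)))) (length-upTo (suc (n + r)))) ⟩
      suc (n + r) + t
        ≡⟨ identity r t ⟩
      suc (2 * n) ∎
      where
      n = r + t
      identity : ∀ r t → suc ((r + t) + r) + t ≡ suc (2 * (r + t))
      identity = solve-∀

    -- (x + t)⁺ runs through r zeros and then 0, 1, …, n.
    sum-fits : sum (map (λ x → (x ℤ.+ + t) ⁺) (filter (fits? (r + t) t) (range (r + t)))) ≡ triangle (r + t)
    sum-fits = begin
      sum (map (λ x → (x ℤ.+ + t) ⁺) (filter (fits? n t) (range n)))
        ≡⟨ cong (sum ∘ map (λ x → (x ℤ.+ + t) ⁺)) filter-fits-range ⟩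
      sum (map (λ x → (x ℤ.+ + t) ⁺) (map point (upTo (suc (n + r)))))
        ≡⟨ cong sum (map-∘ (upTo (suc (n + r)))) ⟨
      sum (map (λ i → (point i ℤ.+ + t) ⁺) (upTo (suc (n + r))))
        ≡⟨ cong sum (map-cong positive-part (upTo (suc (n + r)))) ⟩
      sum (map (_∸ r) (upTo (suc (n + r))))
        ≡⟨ cong (sum ∘ map (_∸ r) ∘ upTo) (identity r t) ⟩
      sum (map (_∸ r) (upTo (r + suc n)))
        ≡⟨ cong sum (map-upTo (_∸ r) (r + suc n)) ⟩
      sum (applyUpTo (_∸ r) (r + suc n))
        ≡⟨ cong sum (applyUpTo-++ (_∸ r) r (suc n)) ⟩
      sum (applyUpTo (_∸ r) r ++ applyUpTo (λ j → r + j ∸ r) (suc n))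
        ≡⟨ sum-++ (applyUpTo (_∸ r) r) _ ⟩
      sum (applyUpTo (_∸ r) r) + sum (applyUpTo (λ j → r + j ∸ r) (suc n))
        ≡⟨ cong₂ _+_ (sum-zero (applyUpTo⁺₁ (_∸ r) r (ℕ.m≤n⇒m∸n≡0 ∘ ℕ.<⇒≤))) (cong sum applyUpTo-[r+j∸r]) ⟩
      triangle n ∎
      where
      n = r + t
      positive-part : ∀ i → (point i ℤ.+ + t) ⁺ ≡ i ∸ r
      positive-part i = trans (cong _⁺ (trans (point+t i) (ℤ.[+m]-[+n]≡m⊖n i r))) ([m⊖n]⁺≡m∸n i r)
      identity : ∀ r t → suc ((r + t) + r) ≡ r + suc (r + t)
      identity = solve-∀
      applyUpTo-[r+j∸r] : applyUpTo (λ j → r + j ∸ r) (suc n) ≡ upTo (suc n)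
      applyUpTo-[r+j∸r] = trans (sym (map-upTo _ (suc n)))
        (trans (map-cong (ℕ.m+n∸m≡n r) (upTo (suc n))) (map-id (upTo (suc n))))

  fits-range : ∀ {n t} → t ≤ n →
    length (filter (fits? n t) (range n)) + t ≡ suc (2 * n) ×
    sum (map (λ x → (x ℤ.+ + t) ⁺) (filter (fits? n t) (range n))) ≡ triangle n
  fits-range {n} {t} t≤n = subst
    (λ n → length (filter (fits? n t) (range n)) + t ≡ suc (2 * n) ×
           sum (map (λ x → (x ℤ.+ + t) ⁺) (filter (fits? n t) (range n))) ≡ triangle n)
    (ℕ.m∸n+n≡m t≤n) (length-fits (n ∸ t) t , sum-fits (n ∸ t) t)

  extensions : ℕ → ∀ {d} → Vec ℤ d → List (Vec ℤ (suc d))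
  extensions n v = map (_∷ v) (filter (fits? n (maxPrefixSum v)) (range n))

  length-extensions : ∀ {n d} {v : Vec ℤ d} → Admissible n v →
                      length (extensions n v) + maxPrefixSum v ≡ suc (2 * n)
  length-extensions {n} {v = v} adm =
    trans (cong (_+ maxPrefixSum v) (length-map (_∷ v) (filter (fits? n (maxPrefixSum v)) (range n))))
          (proj₁ (fits-range (admissible⇒maxPrefixSum≤ {n} adm)))

  maxPrefixSum-extensions : ∀ {n d} {v : Vec ℤ d} → Admissible n v →
                            sum (map maxPrefixSum (extensions n v)) ≡ triangle n
  maxPrefixSum-extensions {n} {v = v} adm =
    trans (cong sum (sym (map-∘ (filter (fits? n (maxPrefixSum v)) (range n)))))
          (proj₂ (fits-range (admissible⇒maxPrefixSum≤ {n} adm)))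

  module _ {n d : ℕ} {v : Vec ℤ d} where

    filter-prepend-admissible : Admissible n v → filter (admissible? n) (map (_∷ v) (range n)) ≡ extensions n v
    filter-prepend-admissible adm = trans (filter-map (admissible? n) (_∷ v) (range n))
      (cong (map (_∷ v)) (filter-≐ (admissible? n ∘ (_∷ v)) (fits? n (maxPrefixSum v)) (proj₂ , (adm ,_)) (range n)))

    filter-prepend-inadmissible : ¬ Admissible n v → filter (admissible? n) (map (_∷ v) (range n)) ≡ []
    filter-prepend-inadmissible ¬adm = trans (filter-map (admissible? n) (_∷ v) (range n))
      (cong (map (_∷ v)) (filter-none (admissible? n ∘ (_∷ v)) (All.universal (λ _ → ¬adm ∘ proj₁) (range n))))

  filter-admissible-cube : ∀ n d →
    filter (admissible? n) (cube n (suc d)) ≡ concatMap (extensions n) (filter (admissible? n) (cube n d))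
  filter-admissible-cube n d = go (cube n d)
    where
    prepend : Vec ℤ d → List (Vec ℤ (suc d))
    prepend v = map (_∷ v) (range n)
    go : ∀ l → filter (admissible? n) (concatMap prepend l) ≡ concatMap (extensions n) (filter (admissible? n) l)
    go []      = refl
    go (v ∷ l) = begin
      filter (admissible? n) (prepend v ++ concatMap prepend l)
        ≡⟨ filter-++ (admissible? n) (prepend v) _ ⟩
      filter (admissible? n) (prepend v) ++ filter (admissible? n) (concatMap prepend l)
        ≡⟨ cong (filter (admissible? n) (prepend v) ++_) (go l) ⟩
      filter (admissible? n) (prepend v) ++ concatMap (extensions n) (filter (admissible? n) l)
        ≡⟨ filter-prepend (admissible? n v) ⟩
      concatMap (extensions n) (filter (admissible? n) (v ∷ l)) ∎
      where
      rest = concatMap (extensions n) (filter (admissible? n) l)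
      filter-prepend : Dec (Admissible n v) →
             filter (admissible? n) (prepend v) ++ rest ≡ concatMap (extensions n) (filter (admissible? n) (v ∷ l))
      filter-prepend (yes adm) = trans (cong (_++ rest) (filter-prepend-admissible adm))
                             (cong (concatMap (extensions n)) (sym (filter-accept (admissible? n) adm)))
      filter-prepend (no ¬adm) = trans (cong (_++ rest) (filter-prepend-inadmissible ¬adm))
                             (cong (concatMap (extensions n)) (sym (filter-reject (admissible? n) ¬adm)))

  module _ (n : ℕ) where

    length-concatMap-extensions : ∀ {d} {A : List (Vec ℤ d)} → All (Admissible n) A →
      length (concatMap (extensions n) A) + sum (map maxPrefixSum A) ≡ suc (2 * n) * length A
    length-concatMap-extensions []                       = sym (ℕ.*-zeroʳ (suc (2 * n)))
    length-concatMap-extensions {A = v ∷ A} (adm ∷ adms) = begin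
      length (extensions n v ++ concatMap (extensions n) A) + (maxPrefixSum v + sum (map maxPrefixSum A))
        ≡⟨ cong (_+ _) (length-++ (extensions n v)) ⟩
      (length (extensions n v) + length (concatMap (extensions n) A)) + (maxPrefixSum v + sum (map maxPrefixSum A))
        ≡⟨ interchange (length (extensions n v)) _ _ _ ⟩
      (length (extensions n v) + maxPrefixSum v) + (length (concatMap (extensions n) A) + sum (map maxPrefixSum A))
        ≡⟨ cong₂ _+_ (length-extensions adm) (length-concatMap-extensions adms) ⟩
      suc (2 * n) + suc (2 * n) * length A
        ≡⟨ ℕ.*-suc (suc (2 * n)) (length A) ⟨
      suc (2 * n) * suc (length A) ∎
      where
      interchange : ∀ a b c d → (a + b) + (c + d) ≡ (a + c) + (b + d)
      interchange = solve-∀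

    maxPrefixSum-concatMap-extensions : ∀ {d} {A : List (Vec ℤ d)} → All (Admissible n) A →
      sum (map maxPrefixSum (concatMap (extensions n) A)) ≡ triangle n * length A
    maxPrefixSum-concatMap-extensions []                       = sym (ℕ.*-zeroʳ (triangle n))
    maxPrefixSum-concatMap-extensions {A = v ∷ A} (adm ∷ adms) = begin
      sum (map maxPrefixSum (extensions n v ++ concatMap (extensions n) A))
        ≡⟨ cong sum (map-++ maxPrefixSum (extensions n v) _) ⟩
      sum (map maxPrefixSum (extensions n v) ++ map maxPrefixSum (concatMap (extensions n) A))
        ≡⟨ sum-++ (map maxPrefixSum (extensions n v)) _ ⟩
      sum (map maxPrefixSum (extensions n v)) + sum (map maxPrefixSum (concatMap (extensions n) A))
        ≡⟨ cong₂ _+_ (maxPrefixSum-extensions adm) (maxPrefixSum-concatMap-extensions adms) ⟩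
      triangle n + triangle n * length A
        ≡⟨ ℕ.*-suc (triangle n) (length A) ⟨
      triangle n * suc (length A) ∎

    admissiblePoints : (d : ℕ) → List (Vec ℤ d)
    admissiblePoints d = filter (admissible? n) (cube n d)

    latticeCount≡length-admissiblePoints : ∀ d → latticeCount d n ≡ length (admissiblePoints d)
    latticeCount≡length-admissiblePoints d =
      cong length (filter-≐ (inDilatedSt? d n) (admissible? n) inDilatedSt≐admissible (cube n d))

    length-admissiblePoints-suc : ∀ d → length (admissiblePoints (suc d)) + sum (map maxPrefixSum (admissiblePoints d)) ≡
                                        suc (2 * n) * length (admissiblePoints d)
    length-admissiblePoints-suc d =
      trans (cong (λ l → length l + sum (map maxPrefixSum (admissiblePoints d))) (filter-admissible-cube n d))
      (length-concatMap-extensions (all-filter (admissible? n) (cube n d)))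

    maxPrefixSum-admissiblePoints-suc : ∀ d → sum (map maxPrefixSum (admissiblePoints (suc d))) ≡
                                              triangle n * length (admissiblePoints d)
    maxPrefixSum-admissiblePoints-suc d = trans (cong (sum ∘ map maxPrefixSum) (filter-admissible-cube n d))
      (maxPrefixSum-concatMap-extensions (all-filter (admissible? n) (cube n d)))

    latticeCount-1 : latticeCount 1 n ≡ suc (2 * n)
    latticeCount-1 = begin
      latticeCount 1 n                       ≡⟨ latticeCount≡length-admissiblePoints 1 ⟩
      length (admissiblePoints 1)            ≡⟨ ℕ.+-identityʳ (length (admissiblePoints 1)) ⟨
      length (admissiblePoints 1) + 0        ≡⟨ length-admissiblePoints-suc 0 ⟩
      suc (2 * n) * 1                        ≡⟨ ℕ.*-identityʳ _ ⟩
      suc (2 * n)                            ∎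

    latticeCount-recurrence : ∀ d → latticeCount (suc (suc d)) n + triangle n * latticeCount d n ≡
                                    suc (2 * n) * latticeCount (suc d) n
    latticeCount-recurrence d = begin
      latticeCount (suc (suc d)) n + triangle n * latticeCount d n
        ≡⟨ cong₂ (λ a b → a + triangle n * b)
                 (latticeCount≡length-admissiblePoints (suc (suc d))) (latticeCount≡length-admissiblePoints d) ⟩
      length (admissiblePoints (suc (suc d))) + triangle n * length (admissiblePoints d)
        ≡⟨ cong (_+_ (length (admissiblePoints (suc (suc d))))) (maxPrefixSum-admissiblePoints-suc d) ⟨
      length (admissiblePoints (suc (suc d))) + sum (map maxPrefixSum (admissiblePoints (suc d)))
        ≡⟨ length-admissiblePoints-suc (suc d) ⟩
      suc (2 * n) * length (admissiblePoints (suc d))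
        ≡⟨ cong (suc (2 * n) *_) (latticeCount≡length-admissiblePoints (suc d)) ⟨
      suc (2 * n) * latticeCount (suc d) n ∎

module RationalCounts where
  open import Data.Nat.Base as ℕ using (ℕ; suc)
  import Data.Nat.Coprimality as Coprime
  open import Data.Integer.Base as ℤ using (+_)
  import Data.Integer.Properties as ℤ
  open import Data.Rational.Base using (ℚ; mkℚ; _/_; 1ℚ; ½; _+_; _*_; _-_)
  import Data.Rational.Properties as ℚ
  open import Data.Rational.Solver using (module +-*-Solver)
  open import Data.Nat.Tactic.RingSolver using () renaming (solve-∀ to Nat-solve-∀)
  open import Relation.Binary.PropositionalEquality
  open +-*-Solver using (solve; _:=_; con; _:+_; _:*_; _:-_)
  open SecondOrderRecurrences using (Solves)
  open HomogeneousForms using (stasheffRecurrence)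
  open Counting using (triangle; 2*triangle; latticeCount-1; latticeCount-recurrence)
  open ≡-Reasoning

  -- On mkℚ records, ℚ._+_ and ℚ._*_ compute.
  fromℕ≡mkℚ : ∀ m → fromℕ m ≡ mkℚ (+ m) 0 (Coprime.sym (Coprime.1-coprimeTo m))
  fromℕ≡mkℚ m = ℚ.↥p/↧p≡p (mkℚ (+ m) 0 (Coprime.sym (Coprime.1-coprimeTo m)))

  fromℕ-+ : ∀ a b → fromℕ (a ℕ.+ b) ≡ fromℕ a + fromℕ b
  fromℕ-+ a b = sym (begin
    fromℕ a + fromℕ b                   ≡⟨ cong₂ _+_ (fromℕ≡mkℚ a) (fromℕ≡mkℚ b) ⟩
    (+ a ℤ.* + 1 ℤ.+ + b ℤ.* + 1) / 1   ≡⟨ cong (_/ 1) (cong₂ ℤ._+_ (ℤ.*-identityʳ (+ a)) (ℤ.*-identityʳ (+ b))) ⟩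
    (+ a ℤ.+ + b) / 1                   ≡⟨ cong (_/ 1) (ℤ.pos-+ a b) ⟨
    fromℕ (a ℕ.+ b)                     ∎)

  fromℕ-* : ∀ a b → fromℕ (a ℕ.* b) ≡ fromℕ a * fromℕ b
  fromℕ-* a b = sym (trans (cong₂ _*_ (fromℕ≡mkℚ a) (fromℕ≡mkℚ b)) (cong (_/ 1) (sym (ℤ.pos-* a b))))

  module _ (n : ℕ) where

    count : ℕ → ℚ
    count d = fromℕ (latticeCount d n)

    u v : ℚ
    u = fromℕ n
    v = 1ℚ + u

    fromℕ-2n+1 : fromℕ (suc (2 ℕ.* n)) ≡ u + v
    fromℕ-2n+1 = begin
      fromℕ (suc (2 ℕ.* n))    ≡⟨ cong fromℕ (identity n) ⟩
      fromℕ (n ℕ.+ (1 ℕ.+ n))  ≡⟨ trans (fromℕ-+ n (1 ℕ.+ n)) (cong (_+_ u) (fromℕ-+ 1 n)) ⟩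
      u + v                    ∎
      where
      identity : ∀ n → suc (2 ℕ.* n) ≡ n ℕ.+ (1 ℕ.+ n)
      identity = Nat-solve-∀

    fromℕ-triangle : fromℕ (triangle n) ≡ ½ * (u * v)
    fromℕ-triangle = begin
      fromℕ (triangle n)
        ≡⟨ solve 1 (λ T → T := con ½ :* (con (fromℕ 2) :* T)) refl (fromℕ (triangle n)) ⟩
      ½ * (fromℕ 2 * fromℕ (triangle n))
        ≡⟨ cong (½ *_) (fromℕ-* 2 (triangle n)) ⟨
      ½ * fromℕ (2 ℕ.* triangle n)
        ≡⟨ cong (λ m → ½ * fromℕ m) (2*triangle n) ⟩
      ½ * fromℕ (n ℕ.* suc n)
        ≡⟨ cong (½ *_) (trans (fromℕ-* n (suc n)) (cong (u *_) (fromℕ-+ 1 n))) ⟩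
      ½ * (u * v) ∎

    count-1 : count 1 ≡ u + v
    count-1 = trans (cong fromℕ (latticeCount-1 n)) fromℕ-2n+1

    count-solves : Solves (stasheffRecurrence u v) count
    count-solves d = begin
      count (suc (suc d))
        ≡⟨ solve 2 (λ c T → c := c :+ T :- T) refl (count (suc (suc d))) (τ * count d) ⟩
      count (suc (suc d)) + τ * count d - τ * count d
        ≡⟨ cong (λ c → c - τ * count d) cast ⟩
      σ * count (suc d) - τ * count d
        ≡⟨ cong₂ (λ s t → s * count (suc d) - t * count d) fromℕ-2n+1 fromℕ-triangle ⟩
      (u + v) * count (suc d) - ½ * (u * v) * count d ∎
      where
      σ = fromℕ (suc (2 ℕ.* n))
      τ = fromℕ (triangle n)
      cast : count (suc (suc d)) + τ * count d ≡ σ * count (suc d)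
      cast = begin
        count (suc (suc d)) + τ * count d
          ≡⟨ cong (_+_ (count (suc (suc d)))) (fromℕ-* (triangle n) (latticeCount d n)) ⟨
        count (suc (suc d)) + fromℕ (triangle n ℕ.* latticeCount d n)
          ≡⟨ fromℕ-+ (latticeCount (suc (suc d)) n) _ ⟨
        fromℕ (latticeCount (suc (suc d)) n ℕ.+ triangle n ℕ.* latticeCount d n)
          ≡⟨ cong fromℕ (latticeCount-recurrence n d) ⟩
        fromℕ (suc (2 ℕ.* n) ℕ.* latticeCount (suc d) n)
          ≡⟨ fromℕ-* (suc (2 ℕ.* n)) (latticeCount (suc d) n) ⟩
        σ * count (suc d) ∎

open import Data.Nat using (ℕ; _≤_)
open import Data.Product using (Σ; _×_; _,_; proj₂)
open import Data.Nat.Properties using (≤-reflexive)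
open import Data.Rational.Base as ℚ using (1ℚ)
open import Data.Vec.Base using (lookup; toList)
open import Data.Vec.Properties using (length-toList)
open import Data.Vec.Relation.Unary.All.Properties using (lookup⁺)
open import Relation.Binary.PropositionalEquality using (_≡_; refl; sym; trans; module ≡-Reasoning)
open HomogeneousForms
open SecondOrderRecurrences using (solution-unique)
open RationalCounts using (count-1; count-solves)
open ≡-Reasoning

⟦stasheffForm⟧≡latticeCount : ∀ n d →
  ⟦ stasheffForm d ⟧ (fromℕ n) (1ℚ ℚ.+ fromℕ n) ≡ fromℕ (latticeCount d n)
⟦stasheffForm⟧≡latticeCount n = solution-unique (stasheffRecurrence (fromℕ n) (1ℚ ℚ.+ fromℕ n))
  (⟦stasheffForm⟧-solves (fromℕ n) (1ℚ ℚ.+ fromℕ n)) (count-solves n)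
  refl (trans (⟦stasheffForm-1⟧ (fromℕ n) (1ℚ ℚ.+ fromℕ n)) (sym (count-1 n)))

theorem1p3 : (d : ℕ) → 1 ≤ d →
    Σ Poly (λ p → IsEhrhartPolynomialOfSt d p × MagicPositive d p)
theorem1p3 d _ = toList (expand T) , isEhrhart , ≤-reflexive (length-toList (expand T)) ,
                 lookup T , lookup⁺ (proj₂ (stasheffPair-nonNegative d)) , isMagicSum
  where
  T = stasheffForm d
  isEhrhart : IsEhrhartPolynomialOfSt d (toList (expand T))
  isEhrhart n _ = begin
    eval (toList (expand T)) (fromℕ n)  ≡⟨ eval-toList (expand T) (fromℕ n) ⟩
    ⟦ expand T ⟧ (fromℕ n) 1ℚ           ≡⟨ ⟦expand⟧ T (fromℕ n) ⟩
    ⟦ T ⟧ (fromℕ n) (1ℚ ℚ.+ fromℕ n)    ≡⟨ ⟦stasheffForm⟧≡latticeCount n d ⟩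
    fromℕ (latticeCount d n)            ∎
  isMagicSum : ∀ x → eval (toList (expand T)) x ≡ magicSum d (lookup T) x
  isMagicSum x = begin
    eval (toList (expand T)) x  ≡⟨ eval-toList (expand T) x ⟩
    ⟦ expand T ⟧ x 1ℚ           ≡⟨ ⟦expand⟧ T x ⟩
    ⟦ T ⟧ x (1ℚ ℚ.+ x)          ≡⟨ magicSum-⟦⟧ d T x ⟨
    magicSum d (lookup T) x     ∎
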